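{- For every natural number $c$ one can find an integer $S=S(c)$ such that the following holds. Consider the process with initial graph $G^{(0)}=G_S$, thresholds $\alpha=\beta=2$, energy $\mathcal{E}^{(t)}(u,v)=|N_{G^{(t)}}(u)\cap N_{G^{(t)}}(v)|$, and interaction set $C^{(t)}$ consisting of all pairs of distinct vertices at distance at most $2$ in $G^{(t)}$. Then the cycle size of this process is at least $c$.
   Context: For an integer $S\ge1$, $[S]=\{0,\dots,S-1\}$ and $G_S$ is the graph on $[S]\times[S]$ in which $(x,y)$ is adjacent to $(x,y\pm1 \bmod S)$ and $(x\pm1\bmod S,y)$ (the $S\times S$ torus grid). Process: given $G^{(t)}$, the graph $G^{(t+1)}$ on the same vertex set is defined by: for each pair $\{u,v\}\in C^{(t)}$, it is an edge of $G^{(t+1)}$ iff $\mathcal{E}^{(t)}(u,v)\ge 2$; pairs not in $C^{(t)}$ keep their status. Since $G^{(t+1)}$ is a deterministic function of $G^{(t)}$ and there are finitely many graphs on the vertex set, the sequence is eventually periodic; its cycle size is the least $p\ge1$ such that $G^{(t+p)}=G^{(t)}$ for all sufficiently large $t$. -}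

module Defs where

open import Data.Nat using (ℕ; zero; suc; _%_; _≤_; _≤ᵇ_; _+_)
import Data.Nat.Properties as ℕP
open import Data.Fin using (Fin; toℕ)
open import Data.Bool using (Bool; true; false; _∧_; _∨_; not; if_then_else_)
open import Data.Product using (_×_; _,_; ∃)
open import Data.List using (List; allFin; cartesianProduct; map)
open import Data.Nat.ListAction using (sum)
open import Data.Bool.ListAction using (any)
open import Function using (_∘_)
open import Relation.Nullary.Decidable using (⌊_⌋)
open import Relation.Binary.PropositionalEquality using (_≡_)

Vertex : ℕ → Set
Vertex S = Fin S × Fin S

Graph : ℕ → Set
Graph S = Vertex S → Vertex S → Bool

vertices : (S : ℕ) → List (Vertex S)
vertices S = cartesianProduct (allFin S) (allFin S)

_==ℕ_ : ℕ → ℕ → Bool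
a ==ℕ b = ⌊ a ℕP.≟ b ⌋

sameV : {S : ℕ} → Vertex S → Vertex S → Bool
sameV (a , b) (c , d) = (toℕ a ==ℕ toℕ c) ∧ (toℕ b ==ℕ toℕ d)

-- a and b differ by ±1 modulo S = suc k
cycAdj : ℕ → ℕ → ℕ → Bool
cycAdj k a b = ((suc a % suc k) ==ℕ b) ∨ ((suc b % suc k) ==ℕ a)

-- The torus grid G_S with S = suc k (so S ≥ 1); no loops (simple graph)
torus : (k : ℕ) → Graph (suc k)
torus k (x , y) (x' , y') =
  not (sameV (x , y) (x' , y')) ∧
  (((toℕ x ==ℕ toℕ x') ∧ cycAdj k (toℕ y) (toℕ y')) ∨
   ((toℕ y ==ℕ toℕ y') ∧ cycAdj k (toℕ x) (toℕ x')))

count : {S : ℕ} → (Vertex S → Bool) → ℕ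
count {S} f = sum (map (λ w → if f w then 1 else 0) (vertices S))

energy : {S : ℕ} → Graph S → Vertex S → Vertex S → ℕ
energy G u v = count (λ w → G u w ∧ G v w)

interacts : {S : ℕ} → Graph S → Vertex S → Vertex S → Bool
interacts {S} G u v = not (sameV u v) ∧ (G u v ∨ any (λ w → G u w ∧ G w v) (vertices S))

-- one step of the process, thresholds α = β = 2
step : {S : ℕ} → Graph S → Graph S
step G u v = if interacts G u v then (2 ≤ᵇ energy G u v) else G u v

iter : {S : ℕ} → ℕ → Graph S → Graph S
iter zero G = G
iter (suc t) G = step (iter t G)

EventualPeriod : {S : ℕ} → Graph S → ℕ → Set
EventualPeriod G p =
  ∃ λ T → ∀ t → T ≤ t → ∀ u v → iter (t + p) G u v ≡ iter t G u v

module Submission where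

-- Write displacements between vertices as pairs of residues mod S.
-- Call a pair of vertices a-axial if their displacement is (0, ±a) or (±a, 0)
-- and a-diagonal if it is (±a, ±a).  Because S is odd (2 is invertible), one
-- step of the process turns the a-axial graph into the a-diagonal graph and
-- the a-diagonal graph into the 2a-axial graph: exactly the new pairs have two
-- common neighbours, and every other pair has at most one.  Starting from the
-- torus (the 1-axial graph), G^(2j) is 2^j-axial and G^(2j+1) is 2^j-diagonal.
-- A pair at displacement (2^T, 0) is adjacent at time 2T; if the process had
-- an eventual period p then p = 2q would be even and 2^q ≡ ±1 (mod S).  For
-- S = 2^(c+1) + 1 this forces q > c, hence p ≥ c.

open import Defs
open import Data.Nat using (ℕ; zero; suc; _≤_; _<_; z≤n; s≤s; _≤ᵇ_; NonZero)
import Data.Nat as ℕ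
import Data.Nat.Properties as ℕP
open import Data.Nat.DivMod using (m%n<n)
open import Data.Nat.Divisibility using (>⇒∤) renaming (_∣_ to _∣ℕ_)
open import Data.Nat.ListAction using (sum)
open import Data.Integer
  using (ℤ; +_; 0ℤ; 1ℤ; _+_; _-_; _*_; -_; ∣_∣; _%ℕ_; _/ℕ_)
open import Data.Integer.Properties
  using (+-inverseʳ; +-identityˡ; +-identityʳ; *-identityˡ; *-identityʳ; *-zeroˡ; *-zeroʳ;
         *-assoc; neg-involutive; neg-distribʳ-*; pos-+; pos-*; +-injective; i-j≡0⇒i≡j;
         ∣i∣≡0⇒i≡0; m-n≡m⊖n; ∣m⊝n∣≤m⊔n)
open import Data.Integer.DivMod using (n%ℕd<d; a≡a%ℕn+[a/ℕn]*n)
open import Data.Integer.Divisibility.Signed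
  using (_∣_; divides; ∣-refl; ∣m∣n⇒∣m+n; ∣m∣n⇒∣m-n; ∣m⇒∣-m; ∣n⇒∣m*n; _∣?_; ∣⇒∣ᵤ)
open import Data.Integer.Tactic.RingSolver using (solve-∀)
open import Data.Fin using (Fin; toℕ; fromℕ<) renaming (zero to fzero)
open import Data.Fin.Properties using (toℕ-injective; toℕ-fromℕ<; toℕ<n)
open import Data.Bool using (Bool; true; false; T; not; _∧_; _∨_; if_then_else_)
open import Data.Bool.Properties using (T-≡; T-∧; T-∨)
open import Data.Unit using (tt)
open import Data.Empty using (⊥; ⊥-elim)
open import Data.Product using (_×_; _,_; proj₁; proj₂; ∃; ∃₂)
import Data.Product as Product
open import Data.Sum using (_⊎_; inj₁; inj₂)
import Data.Sum as Sum
open import Data.List using (List; []; _∷_; map)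
open import Data.List.Membership.Propositional using (_∈_; lose)
open import Data.List.Membership.Propositional.Properties using (∈-cartesianProduct⁺; ∈-allFin)
open import Data.List.Relation.Unary.Any using (here; there)
open import Data.List.Relation.Unary.Any.Properties using (any⁺)
open import Data.List.Relation.Unary.All using (All; []; _∷_)
open import Data.List.Relation.Unary.AllPairs using ([]; _∷_)
open import Data.List.Relation.Unary.Unique.Propositional using (Unique)
open import Data.List.Relation.Unary.Unique.Propositional.Properties
  using (cartesianProduct⁺; allFin⁺)
open import Function.Bundles using (_⇔_; mk⇔; Equivalence)
open import Function.Properties.Equivalence using () renaming (trans to ⇔-trans)
open import Data.Product.Function.NonDependent.Propositional using (_×-⇔_)
open import Data.Sum.Function.Propositional using (_⊎-⇔_)
open Equivalence using (to; from)
open import Relation.Nullary using (¬_; Dec; yes; no)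
open import Relation.Nullary.Decidable using (toWitness; fromWitness; map′; _×-dec_; _⊎-dec_)
open import Relation.Binary.PropositionalEquality
  using (_≡_; _≢_; refl; sym; trans; cong; cong₂; subst; subst₂; module ≡-Reasoning)

tally : {A : Set} → (A → Bool) → List A → ℕ
tally f xs = sum (map (λ w → if f w then 1 else 0) xs)

module _ {A : Set} (f : A → Bool) where

  tally-≥1 : ∀ {xs w} → w ∈ xs → T (f w) → 1 ≤ tally f xs
  tally-≥1 {x ∷ _} (here refl) fx with f x | fx
  ... | true  | _  = s≤s z≤n
  ... | false | ()
  tally-≥1 (there w∈xs) fw = ℕP.≤-trans (tally-≥1 w∈xs fw) (ℕP.m≤n+m _ _)

  tally-≥2 : ∀ {xs w w′} → w ∈ xs → w′ ∈ xs → w ≢ w′ → T (f w) → T (f w′) → 2 ≤ tally f xs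
  tally-≥2 (here refl) (here refl) w≢w′ _ _ = ⊥-elim (w≢w′ refl)
  tally-≥2 {x ∷ _} (here refl) (there w′∈xs) _ fx fw′ with f x | fx
  ... | true  | _  = s≤s (tally-≥1 w′∈xs fw′)
  ... | false | ()
  tally-≥2 {x ∷ _} (there w∈xs) (here refl) _ fw fx with f x | fx
  ... | true  | _  = s≤s (tally-≥1 w∈xs fw)
  ... | false | ()
  tally-≥2 (there w∈xs) (there w′∈xs) w≢w′ fw fw′ =
    ℕP.≤-trans (tally-≥2 w∈xs w′∈xs w≢w′ fw fw′) (ℕP.m≤n+m _ _)

  tally-≡0 : ∀ {x xs} → All (x ≢_) xs → (∀ w → T (f w) → w ≡ x) → tally f xs ≡ 0
  tally-≡0 [] _ = refl
  tally-≡0 {xs = y ∷ _} (x≢y ∷ x∉ys) only-x with f y in fy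
  ... | true  = ⊥-elim (x≢y (sym (only-x y (from T-≡ fy))))
  ... | false = tally-≡0 x∉ys only-x

  tally-≤1 : ∀ {xs} → Unique xs → (∀ w w′ → T (f w) → T (f w′) → w ≡ w′) → tally f xs ≤ 1
  tally-≤1 [] _ = z≤n
  tally-≤1 {x ∷ _} (x∉xs ∷ xs-unique) at-most-one with f x in fx
  ... | true rewrite tally-≡0 x∉xs (λ w fw → at-most-one w x fw (from T-≡ fx)) = s≤s z≤n
  ... | false = tally-≤1 xs-unique at-most-one

  tally-witness : ∀ xs → 1 ≤ tally f xs → ∃ λ w → w ∈ xs × T (f w)
  tally-witness [] ()
  tally-witness (x ∷ xs) pos with f x in fx
  ... | true  = x , here refl , from T-≡ fx
  ... | false = let w , w∈xs , fw = tally-witness xs pos in w , there w∈xs , fw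

==ℕ-reflects : ∀ m n → T (m ==ℕ n) ⇔ (m ≡ n)
==ℕ-reflects m n = mk⇔ (toWitness {a? = m ℕP.≟ n}) (fromWitness {a? = m ℕP.≟ n})

module _ {S : ℕ} where

  every-vertex : (w : Vertex S) → w ∈ vertices S
  every-vertex (a , b) = ∈-cartesianProduct⁺ (∈-allFin a) (∈-allFin b)

  vertices-unique : Unique (vertices S)
  vertices-unique = cartesianProduct⁺ (allFin⁺ S) (allFin⁺ S)

  sameV-sound : {u v : Vertex S} → T (sameV u v) → u ≡ v
  sameV-sound {a , b} {c , d} same =
    let a≡c , b≡d = to (T-∧ {toℕ a ==ℕ toℕ c}) same
    in cong₂ _,_ (toℕ-injective (to (==ℕ-reflects _ _) a≡c))
                   (toℕ-injective (to (==ℕ-reflects _ _) b≡d))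

  sameV-refl : (u : Vertex S) → T (sameV u u)
  sameV-refl (a , b) = from (T-∧ {toℕ a ==ℕ toℕ a})
    (from (==ℕ-reflects (toℕ a) (toℕ a)) refl , from (==ℕ-reflects (toℕ b) (toℕ b)) refl)

  not-sameV : {u v : Vertex S} → T (not (sameV u v)) ⇔ (u ≢ v)
  not-sameV {u} {v} = mk⇔ sound complete
    where
    sound : T (not (sameV u v)) → u ≢ v
    sound ns refl with sameV u u | sameV-refl u
    ... | true  | _  = ns
    ... | false | ()
    complete : u ≢ v → T (not (sameV u v))
    complete u≢v with sameV u v in same
    ... | true  = u≢v (sameV-sound (from T-≡ same))
    ... | false = tt

VRel : ℕ → Set₁
VRel S = Vertex S → Vertex S → Set

Represents : ∀ {S} → Graph S → VRel S → Set
Represents G P = ∀ u v → T (G u v) ⇔ P u v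

module _ {S : ℕ} where

  Common : VRel S → Vertex S → Vertex S → Vertex S → Set
  Common P u v w = P u w × P v w

  TwoCommon : VRel S → VRel S
  TwoCommon P u v = ∃₂ λ w w′ → w ≢ w′ × Common P u v w × Common P u v w′

  AtMostOneCommon : VRel S → VRel S
  AtMostOneCommon P u v = ∀ w w′ → Common P u v w → Common P u v w′ → w ≡ w′

module _ {S : ℕ} (G : Graph S) where

  interacts⇒distinct : ∀ {u v} → T (interacts G u v) → u ≢ v
  interacts⇒distinct i = to not-sameV (proj₁ (to T-∧ i))

  adjacent⇒interacts : ∀ {u v} → u ≢ v → T (G u v) → T (interacts G u v)
  adjacent⇒interacts u≢v uv = from T-∧ (from not-sameV u≢v , from T-∨ (inj₁ uv))

  common⇒interacts : ∀ {u v w} → u ≢ v → T (G u w) → T (G w v) → T (interacts G u v)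
  common⇒interacts {u} {v} {w} u≢v uw wv =
    from T-∧ (from not-sameV u≢v , from T-∨ (inj₂ (any⁺ (λ z → G u z ∧ G z v)
      (lose (every-vertex w) (from T-∧ (uw , wv))))))

  step-of-interacting : ∀ {u v} → T (interacts G u v) → T (2 ≤ᵇ energy G u v) → T (step G u v)
  step-of-interacting {u} {v} i e with interacts G u v | i
  ... | true  | _  = e
  ... | false | ()

  step-edge⇒ : (∀ u → ¬ T (G u u)) → ∀ {u v} → T (step G u v) → u ≢ v × 2 ≤ energy G u v
  step-edge⇒ loopless {u} {v} st with interacts G u v in int
  ... | true  = interacts⇒distinct (from T-≡ int) , ℕP.≤ᵇ⇒≤ 2 _ st
  ... | false = ⊥-elim (subst T int (adjacent⇒interacts u≢v st))
    where
    u≢v : u ≢ v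
    u≢v u≡v = loopless u (subst (λ z → T (G u z)) (sym u≡v) st)

  step-edge⇐ : (∀ u v → T (G u v) → T (G v u)) → ∀ {u v} → u ≢ v → 2 ≤ energy G u v →
               T (step G u v)
  step-edge⇐ symmetric {u} {v} u≢v two
    with tally-witness (λ w → G u w ∧ G v w) (vertices S) (ℕP.≤-trans (s≤s z≤n) two)
  ... | w , _ , uw∧vw =
    let uw , vw = to T-∧ uw∧vw
    in step-of-interacting (common⇒interacts u≢v uw (symmetric v w vw)) (ℕP.≤⇒≤ᵇ two)

step-represents : ∀ {S} (G : Graph S) (P Q : VRel S) → Represents G P →
  (∀ u v → P u v → P v u) → (∀ u → ¬ P u u) →
  (∀ u v → Dec (Q u v)) → (∀ u → ¬ Q u u) →
  (∀ u v → Q u v → TwoCommon P u v) →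
  (∀ u v → u ≢ v → ¬ Q u v → AtMostOneCommon P u v) →
  Represents (step G) Q
step-represents G P Q G≈P P-sym P-irrefl Q? Q-irrefl two-common one-common u v =
  mk⇔ forward backward
  where
  G⇒P : ∀ {u v} → T (G u v) → P u v
  G⇒P = to (G≈P _ _)

  P⇒G : ∀ {u v} → P u v → T (G u v)
  P⇒G = from (G≈P _ _)

  both : ∀ {w} → T (G u w ∧ G v w) → Common P u v w
  both uvw = let uw , vw = to T-∧ uvw in G⇒P uw , G⇒P vw

  forward : T (step G u v) → Q u v
  forward st with Q? u v
  ... | yes q = q
  ... | no ¬q =
    let u≢v , two = step-edge⇒ G (λ w g → P-irrefl w (G⇒P g)) st
    in ⊥-elim (ℕP.<⇒≱ two (tally-≤1 (λ w → G u w ∧ G v w) vertices-unique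
         (λ w w′ c c′ → one-common u v u≢v ¬q w w′ (both c) (both c′))))

  backward : Q u v → T (step G u v)
  backward q =
    let w , w′ , w≢w′ , (uw , vw) , (uw′ , vw′) = two-common u v q
    in step-edge⇐ G (λ x y g → P⇒G (P-sym x y (G⇒P g)))
         (λ u≡v → Q-irrefl u (subst (Q u) (sym u≡v) q))
         (tally-≥2 (λ z → G u z ∧ G v z) (every-vertex w) (every-vertex w′) w≢w′
            (from T-∧ (P⇒G uw , P⇒G vw)) (from T-∧ (P⇒G uw′ , P⇒G vw′)))

neg-diff : ∀ i j → - (i - j) ≡ j - i
neg-diff = solve-∀

minus-neg : ∀ a → a - - a ≡ + 2 * a
minus-neg = solve-∀

halving-step : ∀ t → t - + 2 * t ≡ - t
halving-step = solve-∀

module Congruence (n : ℕ) .{{n≢0 : NonZero n}} where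

  infix 4 _≈_ _≉_ _≈?_

  record _≈_ (i j : ℤ) : Set where
    constructor congruent
    field n∣i-j : + n ∣ i - j
  open _≈_ public

  _≉_ : ℤ → ℤ → Set
  i ≉ j = ¬ (i ≈ j)

  _≈?_ : ∀ i j → Dec (i ≈ j)
  i ≈? j = map′ congruent n∣i-j (+ n ∣? i - j)

  along : ∀ {d e} → d ≡ e → + n ∣ d → + n ∣ e
  along = subst (+ n ∣_)

  ≈-by-diff : ∀ {i j i′ j′} → i - j ≡ i′ - j′ → i ≈ j → i′ ≈ j′
  ≈-by-diff e (congruent d) = congruent (along e d)

  ≈-refl : ∀ {i} → i ≈ i
  ≈-refl {i} = congruent (divides 0ℤ (trans (+-inverseʳ i) (sym (*-zeroˡ (+ n)))))

  ≡⇒≈ : ∀ {i j} → i ≡ j → i ≈ j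
  ≡⇒≈ refl = ≈-refl

  ≈-sym : ∀ {i j} → i ≈ j → j ≈ i
  ≈-sym {i} {j} (congruent n∣i-j) = congruent (along (neg-diff i j) (∣m⇒∣-m n∣i-j))

  ≈-trans : ∀ {i j k} → i ≈ j → j ≈ k → i ≈ k
  ≈-trans {i} {j} {k} (congruent n∣i-j) (congruent n∣j-k) =
    congruent (along (telescope i j k) (∣m∣n⇒∣m+n n∣i-j n∣j-k))
    where
    telescope : ∀ i j k → (i - j) + (j - k) ≡ i - k
    telescope = solve-∀

  ≈-+ : ∀ {i i′ j j′} → i ≈ i′ → j ≈ j′ → i + j ≈ i′ + j′
  ≈-+ {i} {i′} {j} {j′} (congruent n∣i-i′) (congruent n∣j-j′) =
    congruent (along (regroup i i′ j j′) (∣m∣n⇒∣m+n n∣i-i′ n∣j-j′))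
    where
    regroup : ∀ i i′ j j′ → (i - i′) + (j - j′) ≡ (i + j) - (i′ + j′)
    regroup = solve-∀

  ≈-neg : ∀ {i j} → i ≈ j → - i ≈ - j
  ≈-neg {i} {j} (congruent n∣i-j) = congruent (along (negate i j) (∣m⇒∣-m n∣i-j))
    where
    negate : ∀ i j → - (i - j) ≡ - i - - j
    negate = solve-∀

  ≈-- : ∀ {i i′ j j′} → i ≈ i′ → j ≈ j′ → i - j ≈ i′ - j′
  ≈-- i≈i′ j≈j′ = ≈-+ i≈i′ (≈-neg j≈j′)

  diff≈0⇔ : ∀ {i j} → (i - j ≈ 0ℤ) ⇔ (i ≈ j)
  diff≈0⇔ {i} {j} =
    mk⇔ (≈-by-diff (+-identityʳ (i - j))) (≈-by-diff (sym (+-identityʳ (i - j))))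

  ≈⇒≡ : ∀ {x y} → x < n → y < n → + x ≈ + y → x ≡ y
  ≈⇒≡ {x} {y} x<n y<n x≈y =
    +-injective (i-j≡0⇒i≡j (+ x) (+ y) (∣i∣≡0⇒i≡0 (multiple-below (∣⇒∣ᵤ (n∣i-j x≈y)) gap<n)))
    where
    multiple-below : ∀ {d} → n ∣ℕ d → d < n → d ≡ 0
    multiple-below {zero} _ _ = refl
    multiple-below {suc d} n∣d d<n = ⊥-elim (>⇒∤ d<n n∣d)
    gap<n : ∣ + x - + y ∣ < n
    gap<n = ℕP.≤-<-trans (subst (ℕ._≤ x ℕ.⊔ y) (cong ∣_∣ (sym (m-n≡m⊖n x y))) (∣m⊝n∣≤m⊔n x y))
                         (ℕP.⊔-lub x<n y<n)

  %ℕ-≈ : ∀ i → + (i %ℕ n) ≈ i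
  %ℕ-≈ i = congruent (divides (- (i /ℕ n)) (begin
      + (i %ℕ n) - i                              ≡⟨ cong (λ z → + (i %ℕ n) - z) (a≡a%ℕn+[a/ℕn]*n i n) ⟩
      + (i %ℕ n) - (+ (i %ℕ n) + (i /ℕ n) * + n)  ≡⟨ cancel (+ (i %ℕ n)) (i /ℕ n) (+ n) ⟩
      - (i /ℕ n) * + n                            ∎))
    where
    open ≡-Reasoning
    cancel : ∀ r q m → r - (r + q * m) ≡ - q * m
    cancel = solve-∀

  ⟦_⟧ : Fin n → ℤ
  ⟦ x ⟧ = + toℕ x

  ⟦⟧-injective : ∀ {x y} → ⟦ x ⟧ ≈ ⟦ y ⟧ → x ≡ y
  ⟦⟧-injective {x} {y} x≈y = toℕ-injective (≈⇒≡ (toℕ<n x) (toℕ<n y) x≈y)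

  residue : ℤ → Fin n
  residue i = fromℕ< (n%ℕd<d i n)

  residue-≈ : ∀ i → ⟦ residue i ⟧ ≈ i
  residue-≈ i rewrite toℕ-fromℕ< (n%ℕd<d i n) = %ℕ-≈ i

module OddTorus (h : ℕ) where

  S : ℕ
  S = suc (h ℕ.+ h)

  open Congruence S public

  -- 2 is invertible modulo 2h + 1:  i − j = (h + 1)(2i − 2j) − (i − j)(2h + 1).
  cancel-2 : ∀ {i j} → + 2 * i ≈ + 2 * j → i ≈ j
  cancel-2 {i} {j} (congruent S∣2i-2j) =
    congruent (along (inverse i j)
      (∣m∣n⇒∣m-n (∣n⇒∣m*n (1ℤ + + h) S∣2i-2j) (∣n⇒∣m*n (i - j) ∣-refl)))
    where
    open ≡-Reasoning
    identity : ∀ i j H → (1ℤ + H) * (+ 2 * i - + 2 * j) - (i - j) * (1ℤ + (H + H)) ≡ i - j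
    identity = solve-∀
    inverse : ∀ i j → (1ℤ + + h) * (+ 2 * i - + 2 * j) - (i - j) * + S ≡ i - j
    inverse i j = begin
      (1ℤ + + h) * (+ 2 * i - + 2 * j) - (i - j) * + S
        ≡⟨ cong (λ m → (1ℤ + + h) * (+ 2 * i - + 2 * j) - (i - j) * (1ℤ + m)) (pos-+ h h) ⟩
      (1ℤ + + h) * (+ 2 * i - + 2 * j) - (i - j) * (1ℤ + (+ h + + h))
        ≡⟨ identity i j (+ h) ⟩
      i - j ∎

  self-opposite : ∀ {a} → a ≈ - a → a ≈ 0ℤ
  self-opposite {a} a≈-a =
    cancel-2 {j = 0ℤ} (≈-trans (≡⇒≈ (sym (minus-neg a))) (from diff≈0⇔ a≈-a))

  infix 4 _≈±_ _≈±?_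
  _≈±_ : ℤ → ℤ → Set
  o ≈± a = o ≈ a ⊎ o ≈ - a

  _≈±?_ : ∀ o a → Dec (o ≈± a)
  o ≈±? a = (o ≈? a) ⊎-dec (o ≈? - a)

  ≈±-refl : ∀ {a} → a ≈± a
  ≈±-refl = inj₁ ≈-refl

  ≈±-resp : ∀ {a o o′} → o ≈ o′ → o ≈± a → o′ ≈± a
  ≈±-resp o≈o′ = Sum.map (≈-trans (≈-sym o≈o′)) (≈-trans (≈-sym o≈o′))

  ≈±-neg : ∀ {a o} → o ≈± a → - o ≈± a
  ≈±-neg (inj₁ o≈a) = inj₂ (≈-neg o≈a)
  ≈±-neg {a} (inj₂ o≈-a) = inj₁ (≈-trans (≈-neg o≈-a) (≡⇒≈ (neg-involutive a)))

  ≈±-nonzero : ∀ {a o} → a ≉ 0ℤ → o ≈ 0ℤ → ¬ o ≈± a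
  ≈±-nonzero a≉0 o≈0 (inj₁ o≈a) = a≉0 (≈-trans (≈-sym o≈a) o≈0)
  ≈±-nonzero {a} a≉0 o≈0 (inj₂ o≈-a) =
    a≉0 (≈-trans (≡⇒≈ (sym (neg-involutive a))) (≈-neg (≈-trans (≈-sym o≈-a) o≈0)))

  ±-difference : ∀ {a p q} → p ≈± a → q ≈± a → p - q ≈ 0ℤ ⊎ (q ≈ - p × p - q ≈± + 2 * a)
  ±-difference (inj₁ p≈a) (inj₁ q≈a) = inj₁ (from diff≈0⇔ (≈-trans p≈a (≈-sym q≈a)))
  ±-difference (inj₂ p≈-a) (inj₂ q≈-a) = inj₁ (from diff≈0⇔ (≈-trans p≈-a (≈-sym q≈-a)))
  ±-difference {a} (inj₁ p≈a) (inj₂ q≈-a) =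
    inj₂ (≈-trans q≈-a (≈-neg (≈-sym p≈a)) , inj₁ (≈-trans (≈-- p≈a q≈-a) (≡⇒≈ (minus-neg a))))
  ±-difference {a} (inj₂ p≈-a) (inj₁ q≈a) =
    inj₂ ( ≈-trans q≈a (≈-trans (≡⇒≈ (sym (neg-involutive a))) (≈-neg (≈-sym p≈-a)))
         , inj₂ (≈-trans (≈-- p≈-a q≈a) (≡⇒≈ (neg-double a))))
    where
    neg-double : ∀ a → - a - a ≡ - (+ 2 * a)
    neg-double = solve-∀

  Shape : Set₁
  Shape = ℤ → ℤ → Set

  Axial : ℤ → Shape
  Axial a o₁ o₂ = (o₁ ≈ 0ℤ × o₂ ≈± a) ⊎ (o₂ ≈ 0ℤ × o₁ ≈± a)

  Diagonal : ℤ → Shape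
  Diagonal a o₁ o₂ = o₁ ≈± a × o₂ ≈± a

  -- A shape describes an undirected loopless translation-invariant graph on the
  -- torus when it is well defined on residues, symmetric, excludes 0 and is decidable.
  record IsShape (N : Shape) : Set where
    field
      resp    : ∀ {o₁ o₂ o₁′ o₂′} → o₁ ≈ o₁′ → o₂ ≈ o₂′ → N o₁ o₂ → N o₁′ o₂′
      neg     : ∀ {o₁ o₂} → N o₁ o₂ → N (- o₁) (- o₂)
      nonzero : ¬ N 0ℤ 0ℤ
      dec     : ∀ o₁ o₂ → Dec (N o₁ o₂)

  axial-shape : ∀ {a} → a ≉ 0ℤ → IsShape (Axial a)
  axial-shape {a} a≉0 = record
    { resp    = λ e₁ e₂ → Sum.map (Product.map (≈-trans (≈-sym e₁)) (≈±-resp e₂))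
                                  (Product.map (≈-trans (≈-sym e₂)) (≈±-resp e₁))
    ; neg     = Sum.map (Product.map ≈-neg ≈±-neg) (Product.map ≈-neg ≈±-neg)
    ; nonzero = λ { (inj₁ (_ , 0≈±a)) → ≈±-nonzero a≉0 ≈-refl 0≈±a
                  ; (inj₂ (_ , 0≈±a)) → ≈±-nonzero a≉0 ≈-refl 0≈±a }
    ; dec     = λ o₁ o₂ → ((o₁ ≈? 0ℤ) ×-dec (o₂ ≈±? a)) ⊎-dec ((o₂ ≈? 0ℤ) ×-dec (o₁ ≈±? a))
    }

  diagonal-shape : ∀ {a} → a ≉ 0ℤ → IsShape (Diagonal a)
  diagonal-shape {a} a≉0 = record
    { resp    = λ e₁ e₂ → Product.map (≈±-resp e₁) (≈±-resp e₂)
    ; neg     = Product.map ≈±-neg ≈±-neg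
    ; nonzero = λ (0≈±a , _) → ≈±-nonzero a≉0 ≈-refl 0≈±a
    ; dec     = λ o₁ o₂ → (o₁ ≈±? a) ×-dec (o₂ ≈±? a)
    }

  Rigid : Shape → Shape → Set
  Rigid N Q = ∀ {n₁ n₂ m₁ m₂} → N n₁ n₂ → N m₁ m₂ →
    ¬ (n₁ - m₁ ≈ 0ℤ × n₂ - m₂ ≈ 0ℤ) → ¬ Q (n₁ - m₁) (n₂ - m₂) → m₁ ≈ - n₁ × m₂ ≈ - n₂

  ≈±-minus-zero : ∀ {a p q} → q ≈ 0ℤ → p ≈± a → p - q ≈± a
  ≈±-minus-zero {p = p} q≈0 =
    ≈±-resp (≈-sym (≈-trans (≈-- (≈-refl {p}) q≈0) (≡⇒≈ (+-identityʳ p))))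

  ≈±-zero-minus : ∀ {a x y} → x ≈ 0ℤ → y ≈± a → x - y ≈± a
  ≈±-zero-minus {y = y} x≈0 y≈±a =
    ≈±-resp (≈-sym (≈-trans (≈-- x≈0 (≈-refl {y})) (≡⇒≈ (+-identityˡ (- y))))) (≈±-neg y≈±a)

  same-axis : ∀ {a x y p q} → x ≈ 0ℤ → y ≈ 0ℤ → p ≈± a → q ≈± a →
              ¬ (x - y ≈ 0ℤ × p - q ≈ 0ℤ) → y ≈ - x × q ≈ - p
  same-axis x≈0 y≈0 p≈±a q≈±a nonzero with ±-difference p≈±a q≈±a
  ... | inj₁ p-q≈0 = ⊥-elim (nonzero (from diff≈0⇔ (≈-trans x≈0 (≈-sym y≈0)) , p-q≈0))
  ... | inj₂ (q≈-p , _) = ≈-trans y≈0 (≈-sym (≈-neg x≈0)) , q≈-p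

  cross-axes : ∀ {a x p q y} → x ≈ 0ℤ → p ≈± a → q ≈ 0ℤ → y ≈± a → Diagonal a (x - y) (p - q)
  cross-axes x≈0 p≈±a q≈0 y≈±a = ≈±-zero-minus x≈0 y≈±a , ≈±-minus-zero q≈0 p≈±a

  axial-rigid : ∀ {a} → Rigid (Axial a) (Diagonal a)
  axial-rigid (inj₁ (n₁≈0 , n₂≈±a)) (inj₁ (m₁≈0 , m₂≈±a)) nonzero _ =
    same-axis n₁≈0 m₁≈0 n₂≈±a m₂≈±a nonzero
  axial-rigid (inj₂ (n₂≈0 , n₁≈±a)) (inj₂ (m₂≈0 , m₁≈±a)) nonzero _ =
    Product.swap (same-axis n₂≈0 m₂≈0 n₁≈±a m₁≈±a (λ z → nonzero (Product.swap z)))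
  axial-rigid (inj₁ (n₁≈0 , n₂≈±a)) (inj₂ (m₂≈0 , m₁≈±a)) _ ¬diagonal =
    ⊥-elim (¬diagonal (cross-axes n₁≈0 n₂≈±a m₂≈0 m₁≈±a))
  axial-rigid (inj₂ (n₂≈0 , n₁≈±a)) (inj₁ (m₁≈0 , m₂≈±a)) _ ¬diagonal =
    ⊥-elim (¬diagonal (Product.swap (cross-axes n₂≈0 n₁≈±a m₁≈0 m₂≈±a)))

  diagonal-rigid : ∀ {a} → Rigid (Diagonal a) (Axial (+ 2 * a))
  diagonal-rigid (n₁≈±a , n₂≈±a) (m₁≈±a , m₂≈±a) nonzero ¬axial
    with ±-difference n₁≈±a m₁≈±a | ±-difference n₂≈±a m₂≈±a
  ... | inj₁ d₁≈0 | inj₁ d₂≈0 = ⊥-elim (nonzero (d₁≈0 , d₂≈0))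
  ... | inj₁ d₁≈0 | inj₂ (_ , d₂≈±2a) = ⊥-elim (¬axial (inj₁ (d₁≈0 , d₂≈±2a)))
  ... | inj₂ (_ , d₁≈±2a) | inj₁ d₂≈0 = ⊥-elim (¬axial (inj₂ (d₂≈0 , d₁≈±2a)))
  ... | inj₂ (m₁≈-n₁ , _) | inj₂ (m₂≈-n₂ , _) = m₁≈-n₁ , m₂≈-n₂

  -- Offsets o from u such that u + o is a common N-neighbour of u and v = u + d.
  CommonOffset : Shape → ℤ → ℤ → ℤ → ℤ → Set
  CommonOffset N d₁ d₂ o₁ o₂ = N o₁ o₂ × N (o₁ - d₁) (o₂ - d₂)

  TwoCommonOffsets : Shape → ℤ → ℤ → Set
  TwoCommonOffsets N d₁ d₂ = ∃₂ λ o₁ o₂ → ∃₂ λ o₁′ o₂′ →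
    ¬ (o₁ ≈ o₁′ × o₂ ≈ o₂′) × CommonOffset N d₁ d₂ o₁ o₂ × CommonOffset N d₁ d₂ o₁′ o₂′

  -- An a-diagonal displacement d has the axial corners (d₁, 0) and (0, d₂).
  axial-corners : ∀ {a d₁ d₂} → a ≉ 0ℤ → Diagonal a d₁ d₂ →
                  TwoCommonOffsets (Axial a) d₁ d₂
  axial-corners {d₁ = d₁} {d₂} a≉0 (d₁≈±a , d₂≈±a) =
    d₁ , 0ℤ , 0ℤ , d₂ ,
    (λ (d₁≈0 , _) → ≈±-nonzero a≉0 d₁≈0 d₁≈±a) ,
    (inj₂ (≈-refl , d₁≈±a) , inj₁ (≡⇒≈ (+-inverseʳ d₁) , ≈±-zero-minus ≈-refl d₂≈±a)) ,
    (inj₁ (≈-refl , d₂≈±a) , inj₂ (≡⇒≈ (+-inverseʳ d₂) , ≈±-zero-minus ≈-refl d₁≈±a))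

  halve : ∀ {a e} → e ≈± + 2 * a → ∃ λ t → t ≈± a × e ≈ + 2 * t
  halve {a} (inj₁ e≈2a) = a , ≈±-refl , e≈2a
  halve {a} (inj₂ e≈-2a) = - a , inj₂ ≈-refl , ≈-trans e≈-2a (≡⇒≈ (neg-distribʳ-* (+ 2) a))

  minus-double : ∀ {a t e} → t ≈± a → e ≈ + 2 * t → t - e ≈± a
  minus-double {t = t} t≈±a e≈2t =
    ≈±-resp (≈-sym (≈-trans (≈-- (≈-refl {t}) e≈2t) (≡⇒≈ (halving-step t)))) (≈±-neg t≈±a)

  -- A 2a-axial displacement (0, 2t) has the diagonal corners (±a, t);
  -- symmetrically (2t, 0) has the corners (t, ±a).
  diagonal-corners : ∀ {a d₁ d₂} → a ≉ 0ℤ → Axial (+ 2 * a) d₁ d₂ →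
                     TwoCommonOffsets (Diagonal a) d₁ d₂
  diagonal-corners {a} a≉0 (inj₁ (d₁≈0 , d₂≈±2a)) =
    let t , t≈±a , d₂≈2t = halve d₂≈±2a in
    a , t , - a , t ,
    (λ (a≈-a , _) → a≉0 (self-opposite a≈-a)) ,
    ((≈±-refl , t≈±a) , (≈±-minus-zero d₁≈0 ≈±-refl , minus-double t≈±a d₂≈2t)) ,
    ((inj₂ ≈-refl , t≈±a) , (≈±-minus-zero d₁≈0 (inj₂ ≈-refl) , minus-double t≈±a d₂≈2t))
  diagonal-corners {a} a≉0 (inj₂ (d₂≈0 , d₁≈±2a)) =
    let t , t≈±a , d₁≈2t = halve d₁≈±2a in
    t , a , t , - a ,
    (λ (_ , a≈-a) → a≉0 (self-opposite a≈-a)) ,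
    ((t≈±a , ≈±-refl) , (minus-double t≈±a d₁≈2t , ≈±-minus-zero d₂≈0 ≈±-refl)) ,
    ((t≈±a , inj₂ ≈-refl) , (minus-double t≈±a d₁≈2t , ≈±-minus-zero d₂≈0 (inj₂ ≈-refl)))

  δ : Fin S → Fin S → ℤ
  δ x x′ = ⟦ x′ ⟧ - ⟦ x ⟧

  dx dy : Vertex S → Vertex S → ℤ
  dx (x , _) (x′ , _) = δ x x′
  dy (_ , y) (_ , y′) = δ y y′

  Adj : Shape → VRel S
  Adj N u v = N (dx u v) (dy u v)

  δ-self : ∀ x → δ x x ≡ 0ℤ
  δ-self x = +-inverseʳ ⟦ x ⟧

  δ-swap : ∀ x x′ → δ x′ x ≡ - δ x x′
  δ-swap x x′ = sym (neg-diff ⟦ x′ ⟧ ⟦ x ⟧)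

  δ-via : ∀ x x′ z → δ x z - δ x′ z ≡ δ x x′
  δ-via x x′ z = telescope ⟦ x ⟧ ⟦ x′ ⟧ ⟦ z ⟧
    where
    telescope : ∀ x x′ z → (z - x) - (z - x′) ≡ x′ - x
    telescope = solve-∀

  δ-injective : ∀ {z x x′} → δ z x ≈ δ z x′ → x ≡ x′
  δ-injective {z} {x} {x′} δx≈δx′ =
    ⟦⟧-injective (≈-by-diff (add-back ⟦ x ⟧ ⟦ x′ ⟧ ⟦ z ⟧) δx≈δx′)
    where
    add-back : ∀ x x′ z → (x - z) - (x′ - z) ≡ x - x′
    add-back = solve-∀

  δ≈0⇒≡ : ∀ {x x′} → δ x x′ ≈ 0ℤ → x ≡ x′
  δ≈0⇒≡ {x} δ≈0 = sym (δ-injective {x} (≈-trans δ≈0 (≡⇒≈ (sym (δ-self x)))))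

  shift : Fin S → ℤ → Fin S
  shift x o = residue (⟦ x ⟧ + o)

  δ-shift : ∀ x x′ o → δ x′ (shift x o) ≈ o - δ x x′
  δ-shift x x′ o =
    ≈-trans (≈-- (residue-≈ (⟦ x ⟧ + o)) (≈-refl {⟦ x′ ⟧})) (≡⇒≈ (regroup ⟦ x ⟧ ⟦ x′ ⟧ o))
    where
    regroup : ∀ x x′ o → (x + o) - x′ ≡ o - (x′ - x)
    regroup = solve-∀

  δ-shift-self : ∀ x o → δ x (shift x o) ≈ o
  δ-shift-self x o =
    ≈-trans (δ-shift x x o) (≡⇒≈ (trans (cong (λ z → o - z) (δ-self x)) (+-identityʳ o)))

  translate : Vertex S → ℤ → ℤ → Vertex S
  translate (x , y) o₁ o₂ = shift x o₁ , shift y o₂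

  distinct⇒displaced : ∀ {u v} → u ≢ v → ¬ (dx u v ≈ 0ℤ × dy u v ≈ 0ℤ)
  distinct⇒displaced {_ , _} u≢v (dx≈0 , dy≈0) = u≢v (cong₂ _,_ (δ≈0⇒≡ dx≈0) (δ≈0⇒≡ dy≈0))

  module _ {N : Shape} (shape : IsShape N) where
    open IsShape shape

    adj-sym : ∀ u v → Adj N u v → Adj N v u
    adj-sym (x , y) (x′ , y′) uv =
      resp (≡⇒≈ (sym (δ-swap x x′))) (≡⇒≈ (sym (δ-swap y y′))) (neg uv)

    adj-irrefl : ∀ u → ¬ Adj N u u
    adj-irrefl (x , y) uu = nonzero (resp (≡⇒≈ (δ-self x)) (≡⇒≈ (δ-self y)) uu)

    adj-dec : ∀ u v → Dec (Adj N u v)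
    adj-dec u v = dec (dx u v) (dy u v)

    two-common : ∀ u v → TwoCommonOffsets N (dx u v) (dy u v) → TwoCommon (Adj N) u v
    two-common u@(x , y) v@(x′ , y′) (o₁ , o₂ , o₁′ , o₂′ , o≉o′ , c , c′) =
      translate u o₁ o₂ , translate u o₁′ o₂′ , distinct , place c , place c′
      where
      place : ∀ {o₁ o₂} → CommonOffset N (dx u v) (dy u v) o₁ o₂ →
              Common (Adj N) u v (translate u o₁ o₂)
      place {o₁} {o₂} (uw , vw) =
        resp (≈-sym (δ-shift-self x o₁)) (≈-sym (δ-shift-self y o₂)) uw ,
        resp (≈-sym (δ-shift x x′ o₁)) (≈-sym (δ-shift y y′ o₂)) vw
      distinct : translate u o₁ o₂ ≢ translate u o₁′ o₂′
      distinct w≡w′ = o≉o′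
        ( ≈-trans (≈-sym (δ-shift-self x o₁)) (≈-trans (≡⇒≈ (cong (dx u) w≡w′)) (δ-shift-self x o₁′))
        , ≈-trans (≈-sym (δ-shift-self y o₂)) (≈-trans (≡⇒≈ (cong (dy u) w≡w′)) (δ-shift-self y o₂′)) )

  -- For a rigid shape, a non-Q pair u ≠ v has at most one common neighbour,
  -- which must sit at half the displacement from u to v.
  module _ {N Q : Shape} (rigid : Rigid N Q) where

    midpoint : ∀ {u v w} → u ≢ v → ¬ Adj Q u v → Common (Adj N) u v w →
               + 2 * dx u w ≈ dx u v × + 2 * dy u w ≈ dy u v
    midpoint {x , y} {x′ , y′} {z₁ , z₂} u≢v ¬uQv (uw , vw) =
      let m₁≈-n₁ , m₂≈-n₂ = rigid uw vw
            (subst₂ (λ d₁ d₂ → ¬ (d₁ ≈ 0ℤ × d₂ ≈ 0ℤ)) (sym (δ-via x x′ z₁)) (sym (δ-via y y′ z₂))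
                    (distinct⇒displaced u≢v))
            (subst₂ (λ d₁ d₂ → ¬ Q d₁ d₂) (sym (δ-via x x′ z₁)) (sym (δ-via y y′ z₂)) ¬uQv)
      in twice (δ-via x x′ z₁) m₁≈-n₁ , twice (δ-via y y′ z₂) m₂≈-n₂
      where
      twice : ∀ {n m d} → n - m ≡ d → m ≈ - n → + 2 * n ≈ d
      twice {n} refl m≈-n = ≈-trans (≡⇒≈ (sym (minus-neg n))) (≈-- (≈-refl {n}) (≈-sym m≈-n))

    at-most-one : ∀ u v → u ≢ v → ¬ Adj Q u v → AtMostOneCommon (Adj N) u v
    at-most-one (x , y) v u≢v ¬uQv w w′ c c′ =
      let mx , my = midpoint u≢v ¬uQv c
          mx′ , my′ = midpoint u≢v ¬uQv c′
      in cong₂ _,_ (δ-injective {x} (cancel-2 (≈-trans mx (≈-sym mx′))))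
                   (δ-injective {y} (cancel-2 (≈-trans my (≈-sym my′))))

  axial-step : ∀ {a} → a ≉ 0ℤ → ∀ G → Represents G (Adj (Axial a)) →
               Represents (step G) (Adj (Diagonal a))
  axial-step {a} a≉0 G G≈axial =
    step-represents G _ _ G≈axial (adj-sym axial) (adj-irrefl axial)
      (adj-dec diagonal) (adj-irrefl diagonal)
      (λ u v uv → two-common axial u v (axial-corners a≉0 uv))
      (at-most-one {Q = Diagonal a} axial-rigid)
    where
    axial = axial-shape a≉0
    diagonal = diagonal-shape a≉0

  diagonal-step : ∀ {a} → a ≉ 0ℤ → ∀ G → Represents G (Adj (Diagonal a)) →
                  Represents (step G) (Adj (Axial (+ 2 * a)))
  diagonal-step {a} a≉0 G G≈diagonal =
    step-represents G _ _ G≈diagonal (adj-sym diagonal) (adj-irrefl diagonal)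
      (adj-dec axial) (adj-irrefl axial)
      (λ u v uv → two-common diagonal u v (diagonal-corners a≉0 uv))
      (at-most-one {Q = Axial (+ 2 * a)} diagonal-rigid)
    where
    diagonal = diagonal-shape a≉0
    axial = axial-shape {+ 2 * a} (λ 2a≈0 → a≉0 (cancel-2 {j = 0ℤ} 2a≈0))

  successor-mod : ∀ {a b} → b < S → (suc a ℕ.% S ≡ b) ⇔ (+ b - + a ≈ 1ℤ)
  successor-mod {a} {b} b<S = mk⇔ forward backward
    where
    shift-1 : ∀ b a → (b - a) - 1ℤ ≡ b - (1ℤ + a)
    shift-1 = solve-∀
    forward : suc a ℕ.% S ≡ b → + b - + a ≈ 1ℤ
    forward refl = ≈-by-diff (sym (shift-1 (+ (suc a ℕ.% S)) (+ a))) (%ℕ-≈ (+ suc a))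
    backward : + b - + a ≈ 1ℤ → suc a ℕ.% S ≡ b
    backward b-a≈1 = ≈⇒≡ (m%n<n (suc a) S) b<S
      (≈-trans (%ℕ-≈ (+ suc a)) (≈-sym (≈-by-diff (shift-1 (+ b) (+ a)) b-a≈1)))

  opposite-step : ∀ {a b} → (+ a - + b ≈ 1ℤ) ⇔ (+ b - + a ≈ - 1ℤ)
  opposite-step {a} {b} =
    mk⇔ (λ a-b≈1 → ≈-trans (≡⇒≈ (sym (neg-diff (+ a) (+ b)))) (≈-neg a-b≈1))
        (λ b-a≈-1 → ≈-trans (≡⇒≈ (sym (neg-diff (+ b) (+ a)))) (≈-neg b-a≈-1))

  cycAdj-≈± : ∀ {a b} → a < S → b < S → T (cycAdj (h ℕ.+ h) a b) ⇔ (+ b - + a ≈± 1ℤ)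
  cycAdj-≈± {a} {b} a<S b<S =
    ⇔-trans (T-∨ {(suc a ℕ.% S) ==ℕ b})
      (⇔-trans (==ℕ-reflects _ _) (successor-mod b<S) ⊎-⇔
       ⇔-trans (==ℕ-reflects _ _) (⇔-trans (successor-mod a<S) (opposite-step {a} {b})))

  same-coordinate : ∀ x x′ → T (toℕ x ==ℕ toℕ x′) ⇔ (δ x x′ ≈ 0ℤ)
  same-coordinate x x′ = mk⇔
    (λ x=x′ → ≡⇒≈ (trans (cong (δ x) (sym (toℕ-injective (to (==ℕ-reflects _ _) x=x′)))) (δ-self x)))
    (λ δ≈0 → from (==ℕ-reflects _ _) (cong toℕ (δ≈0⇒≡ δ≈0)))

  torus-axial : 1ℤ ≉ 0ℤ → Represents (torus (h ℕ.+ h)) (Adj (Axial 1ℤ))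
  torus-axial 1≉0 u@(x , y) v@(x′ , y′) =
    mk⇔ (λ uv → proj₂ (to description uv)) (λ ax → from description (distinct ax , ax))
    where
    distinct : Adj (Axial 1ℤ) u v → u ≢ v
    distinct ax refl = adj-irrefl (axial-shape 1≉0) u ax
    description : T (torus (h ℕ.+ h) u v) ⇔ (u ≢ v × Adj (Axial 1ℤ) u v)
    description =
      ⇔-trans (T-∧ {not (sameV u v)})
        (not-sameV ×-⇔
         ⇔-trans (T-∨ {(toℕ x ==ℕ toℕ x′) ∧ cycAdj (h ℕ.+ h) (toℕ y) (toℕ y′)})
           (⇔-trans (T-∧ {toℕ x ==ℕ toℕ x′})
              (same-coordinate x x′ ×-⇔ cycAdj-≈± (toℕ<n y) (toℕ<n y′)) ⊎-⇔
            ⇔-trans (T-∧ {toℕ y ==ℕ toℕ y′})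
              (same-coordinate y y′ ×-⇔ cycAdj-≈± (toℕ<n x) (toℕ<n x′))))

  two^ : ℕ → ℤ
  two^ j = + (2 ℕ.^ j)

  two^-suc : ∀ j → two^ (suc j) ≡ + 2 * two^ j
  two^-suc j = pos-* 2 (2 ℕ.^ j)

  two^-+ : ∀ i j → two^ (i ℕ.+ j) ≡ two^ i * two^ j
  two^-+ i j = trans (cong +_ (ℕP.^-distribˡ-+-* 2 i j)) (pos-* (2 ℕ.^ i) (2 ℕ.^ j))

  two^-cancel : ∀ j {x y} → two^ j * x ≈ two^ j * y → x ≈ y
  two^-cancel zero {x} {y} e =
    ≈-trans (≡⇒≈ (sym (*-identityˡ x))) (≈-trans e (≡⇒≈ (*-identityˡ y)))
  two^-cancel (suc j) {x} {y} e =
    two^-cancel j (cancel-2 (≈-trans (≡⇒≈ (sym (regroup x))) (≈-trans e (≡⇒≈ (regroup y)))))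
    where
    regroup : ∀ z → two^ (suc j) * z ≡ + 2 * (two^ j * z)
    regroup z = trans (cong (_* z) (two^-suc j)) (*-assoc (+ 2) (two^ j) z)

  two^≉0 : 1ℤ ≉ 0ℤ → ∀ j → two^ j ≉ 0ℤ
  two^≉0 1≉0 j 2^j≈0 = 1≉0 (two^-cancel j
    (≈-trans (≡⇒≈ (*-identityʳ (two^ j))) (≈-trans 2^j≈0 (≡⇒≈ (sym (*-zeroʳ (two^ j)))))))

  ±-cancel : ∀ j {x y} → two^ j * x ≈± two^ j * y → x ≈± y
  ±-cancel j (inj₁ e) = inj₁ (two^-cancel j e)
  ±-cancel j {y = y} (inj₂ e) =
    inj₂ (two^-cancel j (≈-trans e (≡⇒≈ (neg-distribʳ-* (two^ j) y))))

  module Phases (1≉0 : 1ℤ ≉ 0ℤ) where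

    G₀ : Graph S
    G₀ = torus (h ℕ.+ h)

    even-phase : ∀ j → Represents (iter (2 ℕ.* j) G₀) (Adj (Axial (two^ j)))
    even-phase zero = torus-axial 1≉0
    even-phase (suc j) =
      subst₂ (λ t a → Represents (iter t G₀) (Adj (Axial a))) (sym (ℕP.*-suc 2 j)) (sym (two^-suc j))
        (diagonal-step (two^≉0 1≉0 j) _ (axial-step (two^≉0 1≉0 j) _ (even-phase j)))

    odd-phase : ∀ j → Represents (iter (suc (2 ℕ.* j)) G₀) (Adj (Diagonal (two^ j)))
    odd-phase j = axial-step (two^≉0 1≉0 j) _ (even-phase j)

parity : ∀ p → ∃ λ q → p ≡ 2 ℕ.* q ⊎ p ≡ suc (2 ℕ.* q)
parity zero = 0 , inj₁ refl
parity (suc p) with parity p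
... | q , inj₁ p≡2q   = q , inj₂ (cong suc p≡2q)
... | q , inj₂ p≡2q+1 = suc q , inj₁ (trans (cong suc p≡2q+1) (sym (ℕP.*-suc 2 q)))

module PeriodBound (c : ℕ) where

  h : ℕ
  h = 2 ℕ.^ c

  open OddTorus h

  1≤h : 1 ≤ h
  1≤h = ℕP.m^n>0 2 c

  below-S : ∀ {x} → x ≤ h → x < S
  below-S x≤h = s≤s (ℕP.≤-trans x≤h (ℕP.m≤m+n h h))

  1≉0 : 1ℤ ≉ 0ℤ
  1≉0 1≈0 with ≈⇒≡ {1} {0} (below-S 1≤h) (below-S z≤n) 1≈0
  ... | ()

  open Phases 1≉0

  -- For 1 ≤ q ≤ c both 2^q and 2^q + 1 lie strictly between 1 and S, so 2^q ≢ ±1.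
  power-bound : ∀ {q} → 1 ≤ q → 1ℤ ≈± two^ q → c < q
  power-bound {suc q′} _ 1≈±2^q with suc q′ ℕP.≤? c
  ... | no q≰c = ℕP.≰⇒> q≰c
  ... | yes q≤c = ⊥-elim (excluded 1≈±2^q)
    where
    q = suc q′
    2^q≤h : 2 ℕ.^ q ≤ h
    2^q≤h = ℕP.^-monoʳ-≤ 2 q≤c
    1<2^q : 1 < 2 ℕ.^ q
    1<2^q = ℕP.*-monoʳ-≤ 2 (ℕP.m^n>0 2 q′)
    1+2^q≈0 : 1ℤ ≈ - two^ q → 1ℤ + two^ q ≈ 0ℤ
    1+2^q≈0 1≈-2^q =
      ≈-trans (≡⇒≈ (sym (cong (λ z → 1ℤ + z) (neg-involutive (two^ q))))) (from diff≈0⇔ 1≈-2^q)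
    excluded : 1ℤ ≈± two^ q → ⊥
    excluded (inj₁ 1≈2^q) = ℕP.<⇒≢ 1<2^q (≈⇒≡ (below-S 1≤h) (below-S 2^q≤h) 1≈2^q)
    excluded (inj₂ 1≈-2^q)
      with ≈⇒≡ (s≤s (ℕP.+-mono-≤ 1≤h 2^q≤h)) (below-S z≤n) (1+2^q≈0 1≈-2^q)
    ... | ()

  origin : Vertex S
  origin = fzero , fzero

  target : ℕ → Vertex S
  target m = translate origin (two^ m) 0ℤ

  target-dx : ∀ m → dx origin (target m) ≈ two^ m
  target-dx m = δ-shift-self fzero (two^ m)

  target-dy : ∀ m → dy origin (target m) ≈ 0ℤ
  target-dy m = δ-shift-self fzero 0ℤ

  Linked : ℕ → ℕ → Set
  Linked m t = T (iter t G₀ origin (target m))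

  linked-at-start : ∀ m → Linked m (2 ℕ.* m)
  linked-at-start m = from (even-phase m origin (target m)) (inj₂ (target-dy m , inj₁ (target-dx m)))

  -- If origin and target m are linked at time 2m + p, then p = 2q with
  -- 2^q ≡ ±1: at odd times the graph is diagonal, and at time 2(m + q) it
  -- is 2^(m+q)-axial.
  return-time : ∀ m p → Linked m (2 ℕ.* m ℕ.+ p) → ∃ λ q → p ≡ 2 ℕ.* q × 1ℤ ≈± two^ q
  return-time m p linked with parity p
  ... | q , inj₁ p≡2q =
    q , p≡2q , ±-cancel m (subst₂ _≈±_ (sym (*-identityʳ (two^ m))) (two^-+ m q) 2^m≈±2^m+q)
    where
    time : 2 ℕ.* m ℕ.+ p ≡ 2 ℕ.* (m ℕ.+ q)
    time = trans (cong (2 ℕ.* m ℕ.+_) p≡2q) (sym (ℕP.*-distribˡ-+ 2 m q))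
    2^m≈±2^m+q : two^ m ≈± two^ (m ℕ.+ q)
    2^m≈±2^m+q with to (even-phase (m ℕ.+ q) origin (target m)) (subst (Linked m) time linked)
    ... | inj₁ (dx≈0 , _) = ⊥-elim (two^≉0 1≉0 m (≈-trans (≈-sym (target-dx m)) dx≈0))
    ... | inj₂ (_ , dx≈±2^m+q) = ≈±-resp (target-dx m) dx≈±2^m+q
  ... | q , inj₂ p≡2q+1 = ⊥-elim (≈±-nonzero (two^≉0 1≉0 (m ℕ.+ q)) (target-dy m) (proj₂ diagonal))
    where
    time : 2 ℕ.* m ℕ.+ p ≡ suc (2 ℕ.* (m ℕ.+ q))
    time = trans (cong (2 ℕ.* m ℕ.+_) p≡2q+1)
                 (trans (ℕP.+-suc (2 ℕ.* m) (2 ℕ.* q)) (cong suc (sym (ℕP.*-distribˡ-+ 2 m q))))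
    diagonal : Adj (Diagonal (two^ (m ℕ.+ q))) origin (target m)
    diagonal = to (odd-phase (m ℕ.+ q) origin (target m)) (subst (Linked m) time linked)

  period-bound : ∀ p → 1 ≤ p → EventualPeriod G₀ p → c ≤ p
  period-bound p 1≤p (t₀ , periodic) =
    let q , p≡2q , 1≈±2^q = return-time t₀ p linked-again
    in subst (c ≤_) (sym p≡2q)
         (ℕP.≤-trans (ℕP.<⇒≤ (power-bound (positive q p≡2q) 1≈±2^q)) (ℕP.m≤m+n q (q ℕ.+ 0)))
    where
    linked-again : Linked t₀ (2 ℕ.* t₀ ℕ.+ p)
    linked-again = subst T (sym (periodic (2 ℕ.* t₀) (ℕP.m≤m+n t₀ (t₀ ℕ.+ 0)) origin (target t₀)))
                           (linked-at-start t₀)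
    positive : ∀ q → p ≡ 2 ℕ.* q → 1 ≤ q
    positive (suc _) _ = s≤s z≤n
    positive zero p≡0 with subst (1 ≤_) p≡0 1≤p
    ... | ()

theorem4 : ∀ (c : ℕ) → ∃ λ (k : ℕ) →
    ∀ (p : ℕ) → 1 ≤ p → EventualPeriod (torus k) p → c ≤ p
theorem4 c = 2 ℕ.^ c ℕ.+ 2 ℕ.^ c , PeriodBound.period-bound c
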